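{- Let $E\subset\mathbb{F}_q^2$ and suppose there are exactly $2$ lines through the origin that intersect $E\setminus\{(0,0)\}$. Let $R_E=\{\theta\in\mathrm{SL}_2(\mathbb{F}_q):\theta(E)=E\}$. Then $|R_E|\leq|E|$.
   Context: $\mathrm{SL}_2(\mathbb{F}_q)$ acts on $\mathbb{F}_q^2$ by matrix multiplication on column vectors; $\theta(E)=\{\theta x: x\in E\}$. -}

module Defs where

open import Level using (0ℓ)
open import Data.Bool using (Bool; true)
open import Data.Nat using (ℕ)
open import Data.Product using (_×_; _,_; ∃; Σ)
open import Data.List using (List; length; filterᵇ; cartesianProduct)
open import Data.List.Membership.Propositional using (_∈_)
open import Data.List.Relation.Unary.Unique.Propositional using (Unique)
open import Relation.Binary.PropositionalEquality using (_≡_; _≢_)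
open import Relation.Binary.Definitions using (DecidableEquality)
open import Algebra.Core using (Op₁; Op₂)
open import Algebra.Structures using (IsCommutativeRing)
open import Function.Bundles using (_⇔_)

record FiniteField : Set₁ where
  infixl 6 _+_ _-_
  infixl 7 _*_
  field
    Carrier : Set
    _+_ _*_ : Op₂ Carrier
    -_      : Op₁ Carrier
    0# 1#   : Carrier
    isCommutativeRing : IsCommutativeRing _≡_ _+_ _*_ -_ 0# 1#
    0≢1     : 0# ≢ 1#
    inverse : ∀ x → x ≢ 0# → ∃ λ y → x * y ≡ 1#
    _≟_     : DecidableEquality Carrier
    elements : List Carrier
    elements-unique   : Unique elements
    elements-complete : ∀ x → x ∈ elements

  _-_ : Op₂ Carrier
  x - y = x + (- y)

  q : ℕ
  q = length elements

module _ (F : FiniteField) where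
  open FiniteField F

  Point : Set
  Point = Carrier × Carrier

  origin : Point
  origin = (0# , 0#)

  allPoints : List Point
  allPoints = cartesianProduct elements elements

  Subset : Set
  Subset = Point → Bool

  card : Subset → ℕ
  card E = length (filterᵇ E allPoints)

  -- 2x2 matrix ((a , b) , (c , d)) = [[a, b], [c, d]]
  Matrix : Set
  Matrix = (Carrier × Carrier) × (Carrier × Carrier)

  det : Matrix → Carrier
  det ((a , b) , (c , d)) = a * d - b * c

  InSL2 : Matrix → Set
  InSL2 θ = det θ ≡ 1#

  act : Matrix → Point → Point
  act ((a , b) , (c , d)) (x , y) = (a * x + b * y , c * x + d * y)

  ImageEq : Matrix → Subset → Set
  ImageEq θ E = ∀ y → (E y ≡ true) ⇔ (∃ λ x → E x ≡ true × act θ x ≡ y)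

  InR : Subset → Matrix → Set
  InR E θ = InSL2 θ × ImageEq θ E

  OnLine : Point → Point → Set
  OnLine (v₁ , v₂) p = ∃ λ t → p ≡ (t * v₁ , t * v₂)

  Meets : Subset → Point → Set
  Meets E v = ∃ λ p → E p ≡ true × p ≢ origin × OnLine v p

  ExactlyTwoLines : Subset → Set
  ExactlyTwoLines E =
    Σ Point λ v → Σ Point λ w →
      v ≢ origin × w ≢ origin × (OnLine v w → Data.Empty.⊥) ×
      Meets E v × Meets E w ×
      (∀ p → E p ≡ true → p ≢ origin → Data.Sum._⊎_ (OnLine v p) (OnLine w p))
    where import Data.Empty; import Data.Sum

-- Pick p ∈ E on one of the two lines and r ∈ E on the other, so that det₂ p r ≠ 0.
-- Every θ ∈ R_E preserves det₂ and maps E ∖ {0} into the union of the two lines, so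
-- θ r is the point of E on the line not containing θ p with det₂ (θ p) (θ r) = det₂ p r;
-- on a line that point is unique. Thus θ p determines θ on the basis p, r, and
-- θ ↦ θ p injects R_E into E.
module Submission where

open import Defs
open import Data.Nat using (_≤_)
open import Data.List using (List; length)
open import Data.List.Relation.Unary.All using (All)
open import Data.List.Relation.Unary.Unique.Propositional using (Unique)

open import Level using (0ℓ)
open import Data.Bool using (true; T)
open import Data.Bool.Properties using (T?)
open import Data.Unit using (tt)
open import Data.Fin using (Fin; zero; suc)
open import Data.Fin.Properties using (injective⇒≤)
open import Data.Product using (∃; _,_; proj₁; proj₂; swap)
open import Data.Sum using (_⊎_; inj₁; inj₂)
import Data.Sum as Sum
open import Data.List using (lookup; filterᵇ)
import Data.List.Relation.Unary.All as All
open import Data.List.Relation.Unary.AllPairs using (_∷_)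
open import Data.List.Relation.Unary.Any using (index)
open import Data.List.Membership.Propositional using (_∈_)
open import Data.List.Membership.Propositional.Properties using (∈-lookup; ∈-filter⁺; ∈-cartesianProduct⁺)
open import Data.List.Membership.Setoid.Properties using (index-injective)
open import Relation.Binary.PropositionalEquality
  using (_≡_; _≢_; refl; sym; trans; cong; cong₂; subst; module ≡-Reasoning)
import Relation.Binary.PropositionalEquality as ≡
open import Relation.Nullary using (¬_; contradiction; yes; no)
open import Function.Base using (_∘_)
open import Function.Bundles using (Equivalence)
open import Algebra.Bundles using (CommutativeRing)

Unique-lookup-injective : {A : Set} {xs : List A} → Unique xs →
                          ∀ {i j} → lookup xs i ≡ lookup xs j → i ≡ j
Unique-lookup-injective (_ ∷ _)    {zero}  {zero}  _  = refl
Unique-lookup-injective (x∉xs ∷ _) {zero}  {suc j} eq = contradiction eq (All.lookup x∉xs (∈-lookup j))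
Unique-lookup-injective (x∉xs ∷ _) {suc i} {zero}  eq = contradiction (sym eq) (All.lookup x∉xs (∈-lookup i))
Unique-lookup-injective (_ ∷ uniq) {suc i} {suc j} eq = cong suc (Unique-lookup-injective uniq eq)

module _ {A B : Set} {P : A → Set} (f : A → B)
         (f-injectiveOn : ∀ {x y} → P x → P y → f x ≡ f y → x ≡ y) where

  length-≤-by-injectiveOn : ∀ {xs ys} → Unique xs → All P xs → (∀ {x} → P x → f x ∈ ys) →
                            length xs ≤ length ys
  length-≤-by-injectiveOn {xs} {ys} uniq Pxs f∈ys = injective⇒≤ index-of-image-injective
    where
    P-lookup : ∀ i → P (lookup xs i)
    P-lookup i = All.lookup Pxs (∈-lookup i)

    index-of-image : Fin (length xs) → Fin (length ys)
    index-of-image i = index (f∈ys (P-lookup i))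

    index-of-image-injective : ∀ {i j} → index-of-image i ≡ index-of-image j → i ≡ j
    index-of-image-injective {i} {j} eq =
      Unique-lookup-injective uniq
        (f-injectiveOn (P-lookup i) (P-lookup j)
          (index-injective (≡.setoid B) (f∈ys (P-lookup i)) (f∈ys (P-lookup j)) eq))

-- The ring solvers cannot cancel x - x over an abstract ring, so identities with
-- subtractions are reduced to subtraction-free ones (solved with natural coefficients).
module CommutativeRingDifferences {c ℓ} (R : CommutativeRing c ℓ) where
  open CommutativeRing R hiding (refl; sym; trans)
  open CommutativeRing R using () renaming (refl to ≈-refl; sym to ≈-sym; trans to ≈-trans)
  open import Algebra.Properties.Ring ring using (x[y-z]≈xy-xz; [y-z]x≈yx-zx)
  open import Algebra.Properties.AbelianGroup +-abelianGroup using (⁻¹-anti-homo‿-; ⁻¹-∙-comm)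
  open import Algebra.Solver.Ring.NaturalCoefficients.Default commutativeSemiring using (solve; _:=_; _:+_)
  open import Relation.Binary.Reasoning.Setoid setoid

  x+w≈z+y⇒x-y≈z-w : ∀ {x y z w} → x + w ≈ z + y → x - y ≈ z - w
  x+w≈z+y⇒x-y≈z-w {x} {y} {z} {w} x+w≈z+y = begin
    x - y                 ≈⟨ +-identityʳ (x - y) ⟨
    (x - y) + 0#          ≈⟨ +-congˡ (-‿inverseʳ w) ⟨
    (x - y) + (w - w)     ≈⟨ solve 4 (λ x -y w -w → (x :+ -y) :+ (w :+ -w) := (x :+ w) :+ (-w :+ -y)) ≈-refl x (- y) w (- w) ⟩
    (x + w) + (- w + - y) ≈⟨ +-congʳ x+w≈z+y ⟩
    (z + y) + (- w + - y) ≈⟨ solve 4 (λ z y -w -y → (z :+ y) :+ (-w :+ -y) := (z :+ -w) :+ (y :+ -y)) ≈-refl z y (- w) (- y) ⟩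
    (z - w) + (y - y)     ≈⟨ +-congˡ (-‿inverseʳ y) ⟩
    (z - w) + 0#          ≈⟨ +-identityʳ (z - w) ⟩
    z - w                 ∎

  x+uw≈uz+y⇒x-y≈u[z-w] : ∀ {x y z w} u → x + u * w ≈ u * z + y → x - y ≈ u * (z - w)
  x+uw≈uz+y⇒x-y≈u[z-w] {z = z} {w} u eq = ≈-trans (x+w≈z+y⇒x-y≈z-w eq) (≈-sym (x[y-z]≈xy-xz u z w))

  [x-y][z-w]≈[xz+yw]-[xw+yz] : ∀ x y z w → (x - y) * (z - w) ≈ (x * z + y * w) - (x * w + y * z)
  [x-y][z-w]≈[xz+yw]-[xw+yz] x y z w = begin
    (x - y) * (z - w)                         ≈⟨ x[y-z]≈xy-xz (x - y) z w ⟩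
    (x - y) * z - (x - y) * w                 ≈⟨ +-cong ([y-z]x≈yx-zx z x y) (-‿cong ([y-z]x≈yx-zx w x y)) ⟩
    (x * z - y * z) - (x * w - y * w)         ≈⟨ +-congˡ (⁻¹-anti-homo‿- (x * w) (y * w)) ⟩
    (x * z - y * z) + (y * w - x * w)         ≈⟨ solve 4 (λ a -b c -d → (a :+ -b) :+ (c :+ -d) := (a :+ c) :+ (-d :+ -b)) ≈-refl (x * z) (- (y * z)) (y * w) (- (x * w)) ⟩
    (x * z + y * w) + (- (x * w) + - (y * z)) ≈⟨ +-congˡ (⁻¹-∙-comm (x * w) (y * z)) ⟩
    (x * z + y * w) - (x * w + y * z)         ∎

module _ (F : FiniteField) where
  open FiniteField F

  commutativeRing : CommutativeRing 0ℓ 0ℓ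
  commutativeRing = record { isCommutativeRing = isCommutativeRing }

  open CommutativeRing commutativeRing
    using (*-comm; *-assoc; *-identityˡ; *-identityʳ; zeroˡ; zeroʳ; +-group; commutativeSemiring)
  open import Algebra.Properties.Group +-group using (x∙y⁻¹≈ε⇒x≈y; x≈y⇒x∙y⁻¹≈ε)
  open import Algebra.Solver.Ring.NaturalCoefficients.Default commutativeSemiring
    using (solve; _:=_; _:+_; _:*_)
  open CommutativeRingDifferences commutativeRing
  open ≡-Reasoning

  *-inverse-cancel : ∀ {k k⁻¹} → k * k⁻¹ ≡ 1# → ∀ x → x * k * k⁻¹ ≡ x
  *-inverse-cancel {k} {k⁻¹} k*k⁻¹≡1 x = begin
    x * k * k⁻¹   ≡⟨ *-assoc x k k⁻¹ ⟩
    x * (k * k⁻¹) ≡⟨ cong (x *_) k*k⁻¹≡1 ⟩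
    x * 1#        ≡⟨ *-identityʳ x ⟩
    x             ∎

  *-cancelʳ : ∀ {k} → k ≢ 0# → ∀ {x y} → x * k ≡ y * k → x ≡ y
  *-cancelʳ {k} k≢0 {x} {y} eq with inverse k k≢0
  ... | k⁻¹ , k*k⁻¹≡1 = begin
    x           ≡⟨ *-inverse-cancel k*k⁻¹≡1 x ⟨
    x * k * k⁻¹ ≡⟨ cong (_* k⁻¹) eq ⟩
    y * k * k⁻¹ ≡⟨ *-inverse-cancel k*k⁻¹≡1 y ⟩
    y           ∎

  *-≢0 : ∀ {x y} → x ≢ 0# → y ≢ 0# → x * y ≢ 0#
  *-≢0 {x} {y} x≢0 y≢0 xy≡0 = y≢0 (*-cancelʳ x≢0 (trans (*-comm y x) (trans xy≡0 (sym (zeroˡ x)))))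

  infixr 7 _·_
  _·_ : Carrier → Point F → Point F
  t · v = (t * proj₁ v , t * proj₂ v)

  infix 7 _∙_
  _∙_ : Point F → Point F → Carrier
  u ∙ x = proj₁ u * proj₁ x + proj₂ u * proj₂ x

  ·-≢origin⇒≢0 : ∀ {t} v → t · v ≢ origin F → t ≢ 0#
  ·-≢origin⇒≢0 (v₁ , v₂) t·v≢0 refl = t·v≢0 (cong₂ _,_ (zeroˡ v₁) (zeroˡ v₂))

  det₂ : Point F → Point F → Carrier
  det₂ (x₁ , x₂) (y₁ , y₂) = x₁ * y₂ - x₂ * y₁

  det₂-act : ∀ θ x y → det₂ (act F θ x) (act F θ y) ≡ det F θ * det₂ x y
  det₂-act ((a , b) , (c , d)) (x₁ , x₂) (y₁ , y₂) =
    trans (x+w≈z+y⇒x-y≈z-w expanded) (sym ([x-y][z-w]≈[xz+yw]-[xw+yz] (a * d) (b * c) (x₁ * y₂) (x₂ * y₁)))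
    where
    expanded : (a * x₁ + b * x₂) * (c * y₁ + d * y₂) + ((a * d) * (x₂ * y₁) + (b * c) * (x₁ * y₂))
             ≡ ((a * d) * (x₁ * y₂) + (b * c) * (x₂ * y₁)) + (c * x₁ + d * x₂) * (a * y₁ + b * y₂)
    expanded = solve 8 (λ a b c d x₁ x₂ y₁ y₂ →
      (a :* x₁ :+ b :* x₂) :* (c :* y₁ :+ d :* y₂) :+ ((a :* d) :* (x₂ :* y₁) :+ (b :* c) :* (x₁ :* y₂))
        := ((a :* d) :* (x₁ :* y₂) :+ (b :* c) :* (x₂ :* y₁)) :+ (c :* x₁ :+ d :* x₂) :* (a :* y₁ :+ b :* y₂))
      refl a b c d x₁ x₂ y₁ y₂

  det₂-SL₂ : ∀ {θ} → InSL2 F θ → ∀ x y → det₂ (act F θ x) (act F θ y) ≡ det₂ x y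
  det₂-SL₂ {θ} detθ≡1 x y = begin
    det₂ (act F θ x) (act F θ y) ≡⟨ det₂-act θ x y ⟩
    det F θ * det₂ x y           ≡⟨ cong (_* det₂ x y) detθ≡1 ⟩
    1# * det₂ x y                ≡⟨ *-identityˡ (det₂ x y) ⟩
    det₂ x y                     ∎

  det₂-·ʳ : ∀ e t u → det₂ e (t · u) ≡ t * det₂ e u
  det₂-·ʳ (e₁ , e₂) t (u₁ , u₂) = x+uw≈uz+y⇒x-y≈u[z-w] t
    (solve 5 (λ e₁ e₂ t u₁ u₂ →
      e₁ :* (t :* u₂) :+ t :* (e₂ :* u₁) := t :* (e₁ :* u₂) :+ e₂ :* (t :* u₁))
      refl e₁ e₂ t u₁ u₂)

  det₂-·· : ∀ s u t v → det₂ (s · u) (t · v) ≡ (s * t) * det₂ u v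
  det₂-·· s (u₁ , u₂) t (v₁ , v₂) = x+uw≈uz+y⇒x-y≈u[z-w] (s * t)
    (solve 6 (λ s u₁ u₂ t v₁ v₂ →
      (s :* u₁) :* (t :* v₂) :+ (s :* t) :* (u₂ :* v₁) := (s :* t) :* (u₁ :* v₂) :+ (s :* u₂) :* (t :* v₁))
      refl s u₁ u₂ t v₁ v₂)

  det₂-self : ∀ u → det₂ u u ≡ 0#
  det₂-self (u₁ , u₂) = x≈y⇒x∙y⁻¹≈ε (*-comm u₁ u₂)

  det₂-originˡ : ∀ y → det₂ (origin F) y ≡ 0#
  det₂-originˡ (y₁ , y₂) = x≈y⇒x∙y⁻¹≈ε (trans (zeroˡ y₂) (sym (zeroˡ y₁)))

  det₂-originʳ : ∀ x → det₂ x (origin F) ≡ 0#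
  det₂-originʳ (x₁ , x₂) = x≈y⇒x∙y⁻¹≈ε (trans (zeroʳ x₁) (sym (zeroʳ x₂)))

  det₂-≢0⇒≢originˡ : ∀ {x y} → det₂ x y ≢ 0# → x ≢ origin F
  det₂-≢0⇒≢originˡ {y = y} det≢0 refl = det≢0 (det₂-originˡ y)

  det₂-≢0⇒≢originʳ : ∀ {x y} → det₂ x y ≢ 0# → y ≢ origin F
  det₂-≢0⇒≢originʳ {x} det≢0 refl = det≢0 (det₂-originʳ x)

  -- Cramer's rule for one row of a matrix.
  ∙-det₂ˡ : ∀ u p r → (u ∙ p) * proj₂ r - (u ∙ r) * proj₂ p ≡ proj₁ u * det₂ p r
  ∙-det₂ˡ (u₁ , u₂) (p₁ , p₂) (r₁ , r₂) = x+uw≈uz+y⇒x-y≈u[z-w] u₁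
    (solve 6 (λ u₁ u₂ p₁ p₂ r₁ r₂ →
      (u₁ :* p₁ :+ u₂ :* p₂) :* r₂ :+ u₁ :* (p₂ :* r₁) := u₁ :* (p₁ :* r₂) :+ (u₁ :* r₁ :+ u₂ :* r₂) :* p₂)
      refl u₁ u₂ p₁ p₂ r₁ r₂)

  ∙-det₂ʳ : ∀ u p r → (u ∙ r) * proj₁ p - (u ∙ p) * proj₁ r ≡ proj₂ u * det₂ p r
  ∙-det₂ʳ (u₁ , u₂) (p₁ , p₂) (r₁ , r₂) = x+uw≈uz+y⇒x-y≈u[z-w] u₂
    (solve 6 (λ u₁ u₂ p₁ p₂ r₁ r₂ →
      (u₁ :* r₁ :+ u₂ :* r₂) :* p₁ :+ u₂ :* (p₂ :* r₁) := u₂ :* (p₁ :* r₂) :+ (u₁ :* p₁ :+ u₂ :* p₂) :* r₁)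
      refl u₁ u₂ p₁ p₂ r₁ r₂)

  ∙-determined-by-basis : ∀ {p r} → det₂ p r ≢ 0# → ∀ {u u'} →
                          u ∙ p ≡ u' ∙ p → u ∙ r ≡ u' ∙ r → u ≡ u'
  ∙-determined-by-basis {p} {r} det≢0 {u} {u'} up≡u'p ur≡u'r = cong₂ _,_
    (*-cancelʳ det≢0 (begin
      proj₁ u * det₂ p r                         ≡⟨ ∙-det₂ˡ u p r ⟨
      (u ∙ p) * proj₂ r - (u ∙ r) * proj₂ p      ≡⟨ cong₂ (λ a b → a * proj₂ r - b * proj₂ p) up≡u'p ur≡u'r ⟩
      (u' ∙ p) * proj₂ r - (u' ∙ r) * proj₂ p    ≡⟨ ∙-det₂ˡ u' p r ⟩
      proj₁ u' * det₂ p r                        ∎))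
    (*-cancelʳ det≢0 (begin
      proj₂ u * det₂ p r                         ≡⟨ ∙-det₂ʳ u p r ⟨
      (u ∙ r) * proj₁ p - (u ∙ p) * proj₁ r      ≡⟨ cong₂ (λ a b → b * proj₁ p - a * proj₁ r) up≡u'p ur≡u'r ⟩
      (u' ∙ r) * proj₁ p - (u' ∙ p) * proj₁ r    ≡⟨ ∙-det₂ʳ u' p r ⟩
      proj₂ u' * det₂ p r                        ∎))

  -- act θ x is (row₁ ∙ x , row₂ ∙ x) definitionally.
  act-determined-by-basis : ∀ {p r} → det₂ p r ≢ 0# → ∀ {θ θ'} →
                            act F θ p ≡ act F θ' p → act F θ r ≡ act F θ' r → θ ≡ θ'
  act-determined-by-basis det≢0 θp≡θ'p θr≡θ'r = cong₂ _,_
    (∙-determined-by-basis det≢0 (cong proj₁ θp≡θ'p) (cong proj₁ θr≡θ'r))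
    (∙-determined-by-basis det≢0 (cong proj₂ θp≡θ'p) (cong proj₂ θr≡θ'r))

  proportional⇒onLine : ∀ {v₁ v₂ w₁ w₂} → v₁ ≢ 0# → v₁ * w₂ ≡ v₂ * w₁ → OnLine F (v₁ , v₂) (w₁ , w₂)
  proportional⇒onLine {v₁} {v₂} {w₁} {w₂} v₁≢0 v₁w₂≡v₂w₁ with inverse v₁ v₁≢0
  ... | v₁⁻¹ , v₁v₁⁻¹≡1 = w₁ * v₁⁻¹ , cong₂ _,_ w₁≡ w₂≡
    where
    w₁≡ : w₁ ≡ w₁ * v₁⁻¹ * v₁
    w₁≡ = sym (*-inverse-cancel (trans (*-comm v₁⁻¹ v₁) v₁v₁⁻¹≡1) w₁)

    w₂≡ : w₂ ≡ w₁ * v₁⁻¹ * v₂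
    w₂≡ = *-cancelʳ v₁≢0 (begin
      w₂ * v₁                  ≡⟨ *-comm w₂ v₁ ⟩
      v₁ * w₂                  ≡⟨ v₁w₂≡v₂w₁ ⟩
      v₂ * w₁                  ≡⟨ cong (v₂ *_) w₁≡ ⟩
      v₂ * (w₁ * v₁⁻¹ * v₁)    ≡⟨ solve 4 (λ v₁ v₂ w₁ i → v₂ :* (w₁ :* i :* v₁) := w₁ :* i :* v₂ :* v₁) refl v₁ v₂ w₁ v₁⁻¹ ⟩
      w₁ * v₁⁻¹ * v₂ * v₁      ∎)

  det₂≡0⇒onLine : ∀ {v w} → v ≢ origin F → det₂ v w ≡ 0# → OnLine F v w
  det₂≡0⇒onLine {v₁ , v₂} v≢0 det≡0 with v₁ ≟ 0# | v₂ ≟ 0#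
  ... | yes v₁≡0 | yes v₂≡0 = contradiction (cong₂ _,_ v₁≡0 v₂≡0) v≢0
  ... | no v₁≢0  | _        = proportional⇒onLine v₁≢0 (x∙y⁻¹≈ε⇒x≈y _ _ det≡0)
  ... | yes _    | no v₂≢0  with t , w≡ ← proportional⇒onLine v₂≢0 (sym (x∙y⁻¹≈ε⇒x≈y _ _ det≡0))
    = t , cong swap w≡

  det₂-onLine : ∀ {u x y} → OnLine F u x → OnLine F u y → det₂ x y ≡ 0#
  det₂-onLine {u} (s , refl) (t , refl) = begin
    det₂ (s · u) (t · u) ≡⟨ det₂-·· s u t u ⟩
    (s * t) * det₂ u u   ≡⟨ cong ((s * t) *_) (det₂-self u) ⟩
    (s * t) * 0#         ≡⟨ zeroʳ (s * t) ⟩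
    0#                   ∎

  det₂-onDistinctLines-≢0 : ∀ {v w p r} → v ≢ origin F → ¬ OnLine F v w →
                            OnLine F v p → OnLine F w r → p ≢ origin F → r ≢ origin F → det₂ p r ≢ 0#
  det₂-onDistinctLines-≢0 {v} {w} v≢0 w∉Lv (s , refl) (t , refl) p≢0 r≢0 det≡0 =
    *-≢0 (*-≢0 (·-≢origin⇒≢0 v p≢0) (·-≢origin⇒≢0 w r≢0)) det₂vw≢0 (trans (sym (det₂-·· s v t w)) det≡0)
    where
    det₂vw≢0 : det₂ v w ≢ 0#
    det₂vw≢0 = w∉Lv ∘ det₂≡0⇒onLine v≢0

  onLine-det₂-injective : ∀ {u e x y} → OnLine F u x → OnLine F u y →
                          det₂ e x ≡ det₂ e y → det₂ e x ≢ 0# → x ≡ y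
  onLine-det₂-injective {u} {e} (s , refl) (t , refl) eq det≢0 =
    cong (_· u) (*-cancelʳ det₂eu≢0 (trans (sym (det₂-·ʳ e s u)) (trans eq (det₂-·ʳ e t u))))
    where
    det₂eu≢0 : det₂ e u ≢ 0#
    det₂eu≢0 det≡0 = det≢0 (trans (det₂-·ʳ e s u) (trans (cong (s *_) det≡0) (zeroʳ s)))

  onOtherLine : ∀ {u u' e x} → OnLine F u e → OnLine F u x ⊎ OnLine F u' x → det₂ e x ≢ 0# → OnLine F u' x
  onOtherLine e∈Lu (inj₁ x∈Lu)  det≢0 = contradiction (det₂-onLine e∈Lu x∈Lu) det≢0
  onOtherLine e∈Lu (inj₂ x∈Lu') _     = x∈Lu'

  onTwoLines-det₂-injective : ∀ {v w e x y} →
    OnLine F v e ⊎ OnLine F w e → OnLine F v x ⊎ OnLine F w x → OnLine F v y ⊎ OnLine F w y →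
    det₂ e x ≡ det₂ e y → det₂ e x ≢ 0# → x ≡ y
  onTwoLines-det₂-injective (inj₁ e∈Lv) x∈ y∈ eq det≢0 = onLine-det₂-injective
    (onOtherLine e∈Lv x∈ det≢0) (onOtherLine e∈Lv y∈ (det≢0 ∘ trans eq)) eq det≢0
  onTwoLines-det₂-injective (inj₂ e∈Lw) x∈ y∈ eq det≢0 = onLine-det₂-injective
    (onOtherLine e∈Lw (Sum.swap x∈) det≢0) (onOtherLine e∈Lw (Sum.swap y∈) (det≢0 ∘ trans eq)) eq det≢0

  module _ (E : Subset F) where

    InR⇒preserves : ∀ {θ x} → InR F E θ → E x ≡ true → E (act F θ x) ≡ true
    InR⇒preserves {θ} {x} (_ , θE≡E) Ex = Equivalence.from (θE≡E (act F θ x)) (x , Ex , refl)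

    ∈-filterᵇ-allPoints : ∀ {x} → E x ≡ true → x ∈ filterᵇ E (allPoints F)
    ∈-filterᵇ-allPoints {x} Ex = ∈-filter⁺ (T? ∘ E)
      (∈-cartesianProduct⁺ (elements-complete (proj₁ x)) (elements-complete (proj₂ x)))
      (subst T (sym Ex) tt)

    InR-determined-at : ∀ {v w} → (∀ x → E x ≡ true → x ≢ origin F → OnLine F v x ⊎ OnLine F w x) →
                        ∀ {p r} → E p ≡ true → E r ≡ true → det₂ p r ≢ 0# →
                        ∀ {θ θ'} → InR F E θ → InR F E θ' → act F θ p ≡ act F θ' p → θ ≡ θ'
    InR-determined-at {v} {w} cover {p} {r} Ep Er det≢0 {θ} {θ'} θ∈R θ'∈R θp≡θ'p =
      act-determined-by-basis det≢0 θp≡θ'p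
        (onTwoLines-det₂-injective (onLines θ∈R Ep (det₂-≢0⇒≢originˡ detθ≢0)) (onLines θ∈R Er (det₂-≢0⇒≢originʳ detθ≢0))
          (onLines θ'∈R Er (det₂-≢0⇒≢originʳ detθ'≢0)) (trans detθ≡ (sym detθ'≡)) detθ≢0)
      where
      onLines : ∀ {σ x} → InR F E σ → E x ≡ true → act F σ x ≢ origin F →
                OnLine F v (act F σ x) ⊎ OnLine F w (act F σ x)
      onLines {σ} {x} σ∈R Ex = cover (act F σ x) (InR⇒preserves σ∈R Ex)

      detθ≡ : det₂ (act F θ p) (act F θ r) ≡ det₂ p r
      detθ≡ = det₂-SL₂ (proj₁ θ∈R) p r

      detθ'≡ : det₂ (act F θ p) (act F θ' r) ≡ det₂ p r
      detθ'≡ = trans (cong (λ e → det₂ e (act F θ' r)) θp≡θ'p) (det₂-SL₂ (proj₁ θ'∈R) p r)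

      detθ≢0 : det₂ (act F θ p) (act F θ r) ≢ 0#
      detθ≢0 = det≢0 ∘ trans (sym detθ≡)

      detθ'≢0 : det₂ (act F θ p) (act F θ' r) ≢ 0#
      detθ'≢0 = det≢0 ∘ trans (sym detθ'≡)

lemma2p3 : (F : FiniteField) (E : Subset F) → ExactlyTwoLines F E →
    (Rs : List (Matrix F)) → Unique Rs → All (InR F E) Rs →
    length Rs ≤ card F E
lemma2p3 F E (v , w , v≢0 , _ , w∉Lv , (p , Ep , p≢0 , p∈Lv) , (r , Er , r≢0 , r∈Lw) , cover) Rs uniq Rs⊆R_E =
  length-≤-by-injectiveOn (λ θ → act F θ p) (InR-determined-at F E cover Ep Er det₂pr≢0) uniq Rs⊆R_E
    (λ θ∈R → ∈-filterᵇ-allPoints F E (InR⇒preserves F E θ∈R Ep))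
  where
  det₂pr≢0 : det₂ F p r ≢ FiniteField.0# F
  det₂pr≢0 = det₂-onDistinctLines-≢0 F v≢0 w∉Lv p∈Lv r∈Lw p≢0 r≢0
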